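{- Let $G=(V,E)$ be a finite simple undirected graph, $F$ an optimal module-preserving cograph edit set for $G$, and $H=(V,E\triangle F)$. Let $\mathcal M=\{M^\star_1,\dots,M^\star_n\}$ be the set of all strong modules of $H$ that are not modules of $G$, indexed so that $M^\star_i\subseteq M^\star_j$ implies $i\le j$. For $M^\star\in\mathcal M$ let $P_{M^\star}$ be the inclusion-minimal prime module of $G$ containing $M^\star$, $F_{M^\star}=\{\{x,v\}\in F: x\in M^\star, v\in P_{M^\star}\setminus M^\star\}$, $\sigma_{M^\star_1}=F_{M^\star_1}$, $\sigma_{M^\star_i}=F_{M^\star_i}\setminus\bigcup_{j<i}F_{M^\star_j}$, and $G_i=G\triangle\big(\bigcup_{k=1}^i\sigma_{M^\star_k}\big)$. Then for every $1\le i\le n$, every module of $G$ is a module of $G_i$, and $M^\star_j$ is a module of $G_i$ for every $j\le i$.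
   Context: A module of $G$ is a set $M\subseteq V$ with $N(x)\setminus M=N(y)\setminus M$ for all $x,y\in M$. A module $M$ is strong if $M\cap M'\in\{\emptyset,M,M'\}$ for every module $M'$. A strong module $M$ with $|M|\ge2$ is prime if $G[M]$ and its complement are both connected. A cograph has no induced path on four vertices. For $F\subseteq\binom V2$, $G\triangle F=(V,E\triangle F)$; $F$ is a cograph edit set if $G\triangle F$ is a cograph; optimal if of minimum cardinality; module-preserving if every module of $G$ is a module of $G\triangle F$. Under these hypotheses each $M^\star\in\mathcal M$ lies in some prime module of $G$, so $P_{M^\star}$ is well defined. -}

module Defs where

open import Data.Nat as ℕ using (ℕ; zero; suc; _<?_)
open import Data.Bool using (Bool; true; false; _∧_; _∨_; not; _xor_; if_then_else_)
open import Data.Fin using (Fin; toℕ; _≟_)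
open import Data.Fin.Subset using (Subset; _∈_; _∉_; _∩_; _⊆_; ∣_∣; ⊥)
open import Data.Vec using (lookup)
open import Data.List using (List; allFin; map)
open import Data.Nat.ListAction using (sum)
open import Data.Product using (_×_; Σ)
open import Data.Sum using (_⊎_)
open import Data.Empty renaming (⊥ to Empty)
open import Relation.Nullary using (¬_)
open import Relation.Nullary.Decidable using (⌊_⌋)
open import Relation.Binary.PropositionalEquality using (_≡_)

Adj : ℕ → Set
Adj N = Fin N → Fin N → Bool

-- A symmetric irreflexive relation: a finite simple undirected graph, or
-- equally a set F ⊆ (V choose 2) of unordered pairs.
record SimpleRel (N : ℕ) : Set where
  field
    rel    : Adj N
    sym    : ∀ x y → rel x y ≡ rel y x
    irrefl : ∀ x → rel x x ≡ false
open SimpleRel public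

_△_ : ∀ {N} → Adj N → Adj N → Adj N
(A △ B) x y = A x y xor B x y

size : ∀ {N} → Adj N → ℕ
size {N} A = sum (map (λ i → sum (map (λ j →
  if ⌊ toℕ i <? toℕ j ⌋ ∧ A i j then 1 else 0) (allFin N))) (allFin N))

IsModule : ∀ {N} → Adj N → Subset N → Set
IsModule A M = ∀ x y v → x ∈ M → y ∈ M → v ∉ M → A x v ≡ A y v

IsStrong : ∀ {N} → Adj N → Subset N → Set
IsStrong {N} A M = IsModule A M × (∀ M' → IsModule A M' →
  (M ∩ M' ≡ ⊥) ⊎ (M ∩ M' ≡ M) ⊎ (M ∩ M' ≡ M'))

data Walk {N} (A : Adj N) (M : Subset N) : Fin N → Fin N → Set where
  []  : ∀ {x} → Walk A M x x
  _∷_ : ∀ {x y z} → A x y ≡ true → y ∈ M → Walk A M y z → Walk A M x z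

Connected : ∀ {N} → Adj N → Subset N → Set
Connected A M = ∀ x y → x ∈ M → y ∈ M → Walk A M x y

co : ∀ {N} → Adj N → Adj N
co A x y = not (A x y) ∧ not ⌊ x ≟ y ⌋

IsPrime : ∀ {N} → Adj N → Subset N → Set
IsPrime A M = IsStrong A M × (2 ℕ.≤ ∣ M ∣) × Connected A M × Connected (co A) M

IsCograph : ∀ {N} → Adj N → Set
IsCograph A = ∀ a b c d → ¬ (a ≡ c) → ¬ (b ≡ d) → ¬ (a ≡ d) →
  A a b ≡ true → A b c ≡ true → A c d ≡ true →
  A a c ≡ false → A b d ≡ false → A a d ≡ false → Empty

IsCographEditSet : ∀ {N} → SimpleRel N → SimpleRel N → Set
IsCographEditSet G F = IsCograph (rel G △ rel F)

IsOptimal : ∀ {N} → SimpleRel N → SimpleRel N → Set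
IsOptimal {N} G F = IsCographEditSet G F ×
  (∀ (F' : SimpleRel N) → IsCographEditSet G F' → size (rel F) ℕ.≤ size (rel F'))

IsModulePreserving : ∀ {N} → SimpleRel N → SimpleRel N → Set
IsModulePreserving G F = ∀ M → IsModule (rel G) M → IsModule (rel G △ rel F) M

IsMinPrimeContaining : ∀ {N} → Adj N → Subset N → Subset N → Set
IsMinPrimeContaining A M P = IsPrime A P × M ⊆ P ×
  (∀ Q → IsPrime A Q → M ⊆ Q → Q ⊆ P → Q ≡ P)

orBelow : ∀ {n} → (Fin n → Bool) → ℕ → Bool
orBelow {zero}  f k       = false
orBelow {suc n} f zero    = false
orBelow {suc n} f (suc k) = f Fin.zero ∨ orBelow (λ j → f (Fin.suc j)) k
  where import Data.Fin as Fin

FM : ∀ {N} → Adj N → Subset N → Subset N → Adj N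
FM F M P x y = F x y ∧
  ((lookup M x ∧ lookup P y ∧ not (lookup M y)) ∨
   (lookup M y ∧ lookup P x ∧ not (lookup M x)))

-- σ_i = F_i \ ⋃_{j<i} F_j   (indices shifted to 0..n-1)
σ : ∀ {N n} → Adj N → (Fin n → Subset N) → (Fin n → Subset N) → Fin n → Adj N
σ F Ms P i x y = FM F (Ms i) (P i) x y ∧
  not (orBelow (λ j → FM F (Ms j) (P j) x y) (toℕ i))

Gi : ∀ {N n} → Adj N → Adj N → (Fin n → Subset N) → (Fin n → Subset N) → Fin n → Adj N
Gi G F Ms P i = G △ (λ x y → orBelow (λ k → σ F Ms P k x y) (suc (toℕ i)))

-- Write F_k for the edges of F between M*_k and P_k ∖ M*_k.  Since the σ_k
-- are the F_k made disjoint, ⋃_{k≤i} σ_k = ⋃_{k≤i} F_k, so G_i = G △ ⋃_{k≤i} F_k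
-- and the proof has two ingredients.
--
-- (1) Every module X of G containing M*_k contains P_k.  The minimal module Y
--     of G with M*_k ⊆ Y ⊆ X is prime: it is strong because M*_k is laminar
--     with every module of G (it is strong in H, and modules of G are modules
--     of H), and G[Y] and its complement are connected because a cut of Y
--     would split Y into two modules of G, one of which would contain M*_k.
--     Minimality of P_k then gives P_k ⊆ Y ⊆ X.
-- (2) By (1), each F_k is uniform on every module X of G (for x, y ∈ X and
--     v ∉ X, xv ∈ F_k iff yv ∈ F_k), so X remains a module of G_i.  For j ≤ i,
--     x ∈ M*_j and v ∈ P_j ∖ M*_j the pair xv is edited in G_i exactly as in
--     F, so there G_i agrees with H, of which M*_j is a module; for v ∉ P_j
--     apply the first claim to the module P_j.

module Submission where

open import Defs
open import Data.Nat using (ℕ)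
open import Data.Fin using (Fin; _≤_)
open import Data.Fin.Subset using (Subset; _⊆_)
open import Data.Product using (_×_; ∃)
open import Relation.Nullary using (¬_)
open import Relation.Binary.PropositionalEquality using (_≡_)

open import Function using (_∘_)
open import Data.Nat as ℕ using (zero; suc; s≤s)
import Data.Nat.Properties as ℕP
open import Data.Bool using (Bool; true; false; _∧_; _∨_; not; _xor_)
import Data.Bool as Bool
open import Data.Bool.Properties using (∧-zeroʳ; ∧-identityʳ; not-injective)
open import Data.Fin using (toℕ; _≟_)
import Data.Fin as Fin
import Data.Fin.Properties as FinP
open import Data.Fin.Subset
  using (_∈_; _∉_; _∩_; _∪_; _─_; ⁅_⁆; ⊥; ∣_∣; _-_; inside; outside)
open import Data.Fin.Subset.Properties
open import Data.Vec using (_∷_; lookup; there)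
open import Data.Vec.Properties using ([]=⇒lookup; lookup⇒[]=)
open import Data.Product using (_,_; proj₁; proj₂; Σ)
open import Data.Sum using (_⊎_; inj₁; inj₂)
open import Data.Empty renaming (⊥ to Void) using (⊥-elim)
open import Relation.Nullary using (Dec; yes; no)
open import Relation.Nullary.Decidable using (_×-dec_; _→-dec_; ¬?)
open import Relation.Binary.PropositionalEquality
  using (refl; trans; cong; cong₂; subst; _≢_; module ≡-Reasoning)
  renaming (sym to ≡-sym)

private
  variable
    N : ℕ

orBelow-cong : ∀ {n} {f g : Fin n → Bool} → (∀ j → f j ≡ g j) →
               ∀ k → orBelow f k ≡ orBelow g k
orBelow-cong {zero}  e k       = refl
orBelow-cong {suc n} e zero    = refl
orBelow-cong {suc n} e (suc k) = cong₂ _∨_ (e Fin.zero) (orBelow-cong (e ∘ Fin.suc) k)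

-- Making a family disjoint (keeping f j only where no earlier f holds) does
-- not change its union; this is why ⋃_{k≤i} σ_k = ⋃_{k≤i} F_k.
orBelow-disjointify : ∀ {n} (f : Fin n → Bool) k →
  orBelow (λ j → f j ∧ not (orBelow f (toℕ j))) k ≡ orBelow f k
orBelow-disjointify {zero}  f k       = refl
orBelow-disjointify {suc n} f zero    = refl
orBelow-disjointify {suc n} f (suc k) with f Fin.zero
... | true  = refl
... | false = orBelow-disjointify (f ∘ Fin.suc) k

orBelow-witness : ∀ {n} (f : Fin n → Bool) j k → f j ≡ true → toℕ j ℕ.< k →
                  orBelow f k ≡ true
orBelow-witness {suc n} f Fin.zero    (suc k) fj _ rewrite fj = refl
orBelow-witness {suc n} f (Fin.suc j) (suc k) fj (s≤s j<k) with f Fin.zero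
... | true  = refl
... | false = orBelow-witness (f ∘ Fin.suc) j k fj j<k

orBelow-none : ∀ {n} (f : Fin n → Bool) k → (∀ j → f j ≡ false) → orBelow f k ≡ false
orBelow-none {zero}  f k       _ = refl
orBelow-none {suc n} f zero    _ = refl
orBelow-none {suc n} f (suc k) none rewrite none Fin.zero =
  orBelow-none (f ∘ Fin.suc) k (none ∘ Fin.suc)

xor-cancelˡ : ∀ {a a' b c : Bool} → a ≡ a' → a xor b ≡ a' xor c → b ≡ c
xor-cancelˡ {true}  refl e = not-injective e
xor-cancelˡ {false} refl e = e

∈⇒lookup : ∀ {x : Fin N} {p} → x ∈ p → lookup p x ≡ true
∈⇒lookup = []=⇒lookup

∉⇒lookup : ∀ {x : Fin N} {p} → x ∉ p → lookup p x ≡ false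
∉⇒lookup {x = x} {p} x∉p with lookup p x in eq
... | true  = ⊥-elim (x∉p (lookup⇒[]= x p eq))
... | false = refl

x∈p─q⇒x∉q : ∀ {x : Fin N} {p q : Subset N} → x ∈ p ─ q → x ∉ q
x∈p─q⇒x∉q {p = _ ∷ p} {inside  ∷ q} (there m) (there n) = x∈p─q⇒x∉q {p = p} {q} m n
x∈p─q⇒x∉q {p = _ ∷ p} {outside ∷ q} (there m) (there n) = x∈p─q⇒x∉q {p = p} {q} m n

⊈⇒witness : ∀ {p q : Subset N} → ¬ (p ⊆ q) → ∃ λ x → x ∈ p × x ∉ q
⊈⇒witness {p = p} {q} p⊈q with FinP.any? (λ x → (x ∈? p) ×-dec ¬? (x ∈? q))
... | yes w   = w
... | no none = ⊥-elim (p⊈q included)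
  where
  included : p ⊆ q
  included {x} x∈p with x ∈? q
  ... | yes x∈q = x∈q
  ... | no  x∉q = ⊥-elim (none (x , x∈p , x∉q))

distinct⇒∣p∣≥2 : ∀ {p : Subset N} {x y : Fin N} → x ∈ p → y ∈ p → x ≢ y → 2 ℕ.≤ ∣ p ∣
distinct⇒∣p∣≥2 {p = p} {x} {y} x∈p y∈p x≢y = ℕP.≤-trans (s≤s ∣p-x∣≥1) (x∈p⇒∣p-x∣<∣p∣ x∈p)
  where
  y∈p-x : y ∈ p - x
  y∈p-x = x∈p∧x≢y⇒x∈p-y y∈p (x≢y ∘ ≡-sym)
  ∣p-x∣≥1 : 1 ℕ.≤ ∣ p - x ∣
  ∣p-x∣≥1 = ℕP.≤-trans (ℕP.≤-reflexive (≡-sym (∣⁅x⁆∣≡1 y)))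
              (p⊆q⇒∣p∣≤∣q∣ (λ m → subst (_∈ p - x) (≡-sym (x∈⁅y⁆⇒x≡y y m)) y∈p-x))

-- Two sets are laminar if they are disjoint or nested; a module is strong
-- exactly when it is laminar with every module.
data Laminar (M M' : Subset N) : Set where
  disjoint : (∀ {z} → z ∈ M → z ∈ M' → Void) → Laminar M M'
  within   : M ⊆ M' → Laminar M M'
  around   : M' ⊆ M → Laminar M M'

∩-Trichotomy : Subset N → Subset N → Set
∩-Trichotomy M M' = (M ∩ M' ≡ ⊥) ⊎ (M ∩ M' ≡ M) ⊎ (M ∩ M' ≡ M')

trichotomy⇒laminar : ∀ {M M' : Subset N} → ∩-Trichotomy M M' → Laminar M M'
trichotomy⇒laminar {M = M} {M'} (inj₁ e) =
  disjoint λ a b → ∉⊥ (subst (_ ∈_) e (x∈p∩q⁺ (a , b)))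
trichotomy⇒laminar {M = M} {M'} (inj₂ (inj₁ e)) =
  within λ a → proj₂ (x∈p∩q⁻ M M' (subst (_ ∈_) (≡-sym e) a))
trichotomy⇒laminar {M = M} {M'} (inj₂ (inj₂ e)) =
  around λ a → proj₁ (x∈p∩q⁻ M M' (subst (_ ∈_) (≡-sym e) a))

laminar⇒trichotomy : ∀ {M M' : Subset N} → Laminar M M' → ∩-Trichotomy M M'
laminar⇒trichotomy {M = M} {M'} (disjoint d) =
  inj₁ (⊆-antisym (λ z → let (a , b) = x∈p∩q⁻ M M' z in ⊥-elim (d a b)) (⊆-min _))
laminar⇒trichotomy {M = M} {M'} (within s) =
  inj₂ (inj₁ (⊆-antisym (p∩q⊆p M M') (λ a → x∈p∩q⁺ (a , s a))))
laminar⇒trichotomy {M = M} {M'} (around s) =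
  inj₂ (inj₂ (⊆-antisym (p∩q⊆q M M') (λ a → x∈p∩q⁺ (s a , a))))

SymmetricAdj : Adj N → Set
SymmetricAdj A = ∀ x y → A x y ≡ A y x

module? : (A : Adj N) (M : Subset N) → Dec (IsModule A M)
module? A M = FinP.all? λ x → FinP.all? λ y → FinP.all? λ v →
  (x ∈? M) →-dec (y ∈? M) →-dec (¬? (v ∈? M)) →-dec (A x v Bool.≟ A y v)

module-≐ : ∀ {A : Adj N} {S T : Subset N} → S ⊆ T → T ⊆ S → IsModule A T → IsModule A S
module-≐ S⊆T T⊆S mT x y v x∈S y∈S v∉S = mT x y v (S⊆T x∈S) (S⊆T y∈S) (v∉S ∘ T⊆S)

module-∩ : ∀ {A : Adj N} {X Y : Subset N} → IsModule A X → IsModule A Y → IsModule A (X ∩ Y)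
module-∩ {X = X} {Y} mX mY x y v x∈ y∈ v∉ with v ∈? X | v ∈? Y
... | yes v∈X | yes v∈Y = ⊥-elim (v∉ (x∈p∩q⁺ (v∈X , v∈Y)))
... | no  v∉X | _       = mX x y v (proj₁ (x∈p∩q⁻ X Y x∈)) (proj₁ (x∈p∩q⁻ X Y y∈)) v∉X
... | yes _   | no  v∉Y = mY x y v (proj₂ (x∈p∩q⁻ X Y x∈)) (proj₂ (x∈p∩q⁻ X Y y∈)) v∉Y

-- If two modules X, Y overlap properly (w ∈ Y ∖ X), then X ∖ Y is a module:
-- a vertex v ∈ X ∩ Y sees X ∖ Y exactly as the outside vertex w does.
module-─ : ∀ {A : Adj N} → SymmetricAdj A → {X Y : Subset N} →
  IsModule A X → IsModule A Y → ∀ w → w ∈ Y → w ∉ X → IsModule A (X ─ Y)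
module-─ {A = A} sym {X} {Y} mX mY w w∈Y w∉X x y v x∈ y∈ v∉ with v ∈? X
... | no v∉X = mX x y v (p─q⊆p X Y x∈) (p─q⊆p X Y y∈) v∉X
... | yes v∈X with v ∈? Y
...   | no  v∉Y = ⊥-elim (v∉ (x∈p∧x∉q⇒x∈p─q v∈X v∉Y))
...   | yes v∈Y = begin
    A x v ≡⟨ sym x v ⟩
    A v x ≡⟨ mY v w x v∈Y w∈Y (x∈p─q⇒x∉q {p = X} x∈) ⟩
    A w x ≡⟨ sym w x ⟩
    A x w ≡⟨ mX x y w (p─q⊆p X Y x∈) (p─q⊆p X Y y∈) w∉X ⟩
    A y w ≡⟨ sym y w ⟩
    A w y ≡⟨ mY w v y w∈Y v∈Y (x∈p─q⇒x∉q {p = X} y∈) ⟩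
    A v y ≡⟨ sym v y ⟩
    A y v ∎
  where open ≡-Reasoning

module Reachability {N} (B : Adj N) (Y : Subset N) (x : Fin N) where

  Closed : Subset N → Set
  Closed R = ∀ u z → u ∈ R → z ∈ Y → B u z ≡ true → z ∈ R

  WalkOrCut : Fin N → Set
  WalkOrCut y = Walk B Y x y ⊎ Σ (Subset N) λ R → x ∈ R × y ∉ R × Closed R

  extend : ∀ {a u z} → Walk B Y a u → B u z ≡ true → z ∈ Y → Walk B Y a z
  extend []             e z∈Y = _∷_ e z∈Y []
  extend (_∷_ e₀ m₀ w) e z∈Y = _∷_ e₀ m₀ (extend w e z∈Y)

  -- Grow a set S of vertices reachable from x by one B-edge into Y at a
  -- time; once no edge leaves S it is closed.  The fuel c bounds the number
  -- of vertices that can still be added.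
  grow : ∀ c (S : Subset N) → N ℕ.≤ c ℕ.+ ∣ S ∣ → x ∈ S →
         (∀ {z} → z ∈ S → Walk B Y x z) → ∀ y → WalkOrCut y
  grow c S bound x∈S reach y
    with FinP.any? (λ u → FinP.any? λ z →
           (u ∈? S) ×-dec (z ∈? Y) ×-dec (B u z Bool.≟ true) ×-dec ¬? (z ∈? S))
  ... | yes (u , z , u∈S , z∈Y , e , z∉S) = step c bound
    where
    S' : Subset N
    S' = S ∪ ⁅ z ⁆
    larger : ∣ S ∣ ℕ.< ∣ S' ∣
    larger = p⊂q⇒∣p∣<∣q∣ ((λ a → x∈p∪q⁺ (inj₁ a)) , z , x∈p∪q⁺ (inj₂ (x∈⁅x⁆ z)) , z∉S)
    reach' : ∀ {w} → w ∈ S' → Walk B Y x w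
    reach' m with x∈p∪q⁻ S ⁅ z ⁆ m
    ... | inj₁ w∈S = reach w∈S
    ... | inj₂ w∈z rewrite x∈⁅y⁆⇒x≡y z w∈z = extend (reach u∈S) e z∈Y
    step : ∀ c → N ℕ.≤ c ℕ.+ ∣ S ∣ → WalkOrCut y
    step zero    bound' = ⊥-elim (ℕP.<⇒≱ (ℕP.<-≤-trans larger (∣p∣≤n S')) bound')
    step (suc c) bound' = grow c S'
      (ℕP.≤-trans bound' (ℕP.≤-trans (ℕP.≤-reflexive (≡-sym (ℕP.+-suc c ∣ S ∣)))
                                      (ℕP.+-monoʳ-≤ c larger)))
      (x∈p∪q⁺ (inj₁ x∈S)) reach' y
  ... | no stuck with y ∈? S
  ...   | yes y∈S = inj₁ (reach y∈S)
  ...   | no  y∉S = inj₂ (S , x∈S , y∉S , closed)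
    where
    closed : Closed S
    closed u z u∈S z∈Y e with z ∈? S
    ... | yes z∈S = z∈S
    ... | no  z∉S = ⊥-elim (stuck (u , z , u∈S , z∈Y , e , z∉S))

  walk-or-cut : ∀ y → WalkOrCut y
  walk-or-cut = grow N ⁅ x ⁆ (ℕP.m≤m+n N _) (x∈⁅x⁆ x)
    (λ m → subst (Walk B Y x) (≡-sym (x∈⁅y⁆⇒x≡y x m)) [])

co-sym : (A : Adj N) → SymmetricAdj A → SymmetricAdj (co A)
co-sym A sym x y rewrite sym x y with x ≟ y | y ≟ x
... | yes _   | yes _   = refl
... | no  _   | no  _   = refl
... | yes x≡y | no  y≢x = ⊥-elim (y≢x (≡-sym x≡y))
... | no  x≢y | yes y≡x = ⊥-elim (x≢y (≡-sym y≡x))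

co-nonedge⇒edge : (A : Adj N) → ∀ a v → a ≢ v → co A a v ≡ false → A a v ≡ true
co-nonedge⇒edge A a v a≢v e with A a v | a ≟ v
... | true  | _       = refl
... | false | yes a≡v = ⊥-elim (a≢v a≡v)
... | false | no  _   with e
...   | ()

cut-modules : ∀ {A : Adj N} → SymmetricAdj A → (c : Bool) {Y R : Subset N} →
  IsModule A Y → R ⊆ Y → (∀ a v → a ∈ R → v ∈ Y ─ R → A a v ≡ c) →
  IsModule A R × IsModule A (Y ─ R)
cut-modules {A = A} sym c {Y} {R} mY R⊆Y across = module-R , module-Y─R
  where
  module-R : IsModule A R
  module-R a b v a∈R b∈R v∉R with v ∈? Y
  ... | yes v∈Y = trans (across a v a∈R (x∈p∧x∉q⇒x∈p─q v∈Y v∉R))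
                        (≡-sym (across b v b∈R (x∈p∧x∉q⇒x∈p─q v∈Y v∉R)))
  ... | no  v∉Y = mY a b v (R⊆Y a∈R) (R⊆Y b∈R) v∉Y
  across' : ∀ a v → a ∈ Y ─ R → v ∈ R → A a v ≡ c
  across' a v a∈ v∈R = trans (sym a v) (across v a v∈R a∈)
  module-Y─R : IsModule A (Y ─ R)
  module-Y─R a b v a∈ b∈ v∉ with v ∈? Y
  ... | no  v∉Y = mY a b v (p─q⊆p Y R a∈) (p─q⊆p Y R b∈) v∉Y
  ... | yes v∈Y with v ∈? R
  ...   | no  v∉R = ⊥-elim (v∉ (x∈p∧x∉q⇒x∈p─q v∈Y v∉R))
  ...   | yes v∈R = trans (across' a v a∈ v∈R) (≡-sym (across' b v b∈ v∈R))

-- Throughout, M is not a module of the symmetric graph A but is laminar with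
-- every module of A.  (In the theorem, M = M*_k: it is strong in H and every
-- module of G is a module of H.)

module Primality {N} (A : Adj N) (sym : SymmetricAdj A) (M : Subset N)
  (M-not-module : ¬ IsModule A M) (M-laminar : ∀ X → IsModule A X → Laminar M X) where

  -- M has two distinct elements, since sets with at most one are modules.
  two-elements : ∃ λ x → ∃ λ y → x ∈ M × y ∈ M × x ≢ y
  two-elements with FinP.any? (λ x → FinP.any? λ y → (x ∈? M) ×-dec (y ∈? M) ×-dec ¬? (x ≟ y))
  ... | yes w = w
  ... | no none = ⊥-elim (M-not-module singleton-module)
    where
    singleton-module : IsModule A M
    singleton-module x y v x∈M y∈M _ with x ≟ y
    ... | yes refl = refl
    ... | no  x≢y  = ⊥-elim (none (x , y , x∈M , y∈M , x≢y))

  one-side : ∀ {Y R : Subset N} → IsModule A Y → M ⊆ Y → IsModule A R → IsModule A (Y ─ R) →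
             M ⊆ R ⊎ M ⊆ Y ─ R
  one-side {Y} {R} mY M⊆Y mR mY─R with M-laminar R mR | M-laminar (Y ─ R) mY─R
  ... | within M⊆R  | _           = inj₁ M⊆R
  ... | _           | within M⊆Y─R = inj₂ M⊆Y─R
  ... | disjoint d₁ | disjoint d₂ = ⊥-elim (M-not-module λ x _ _ x∈M → ⊥-elim (side x∈M (d₁ x∈M) (d₂ x∈M)))
    where
    side : ∀ {z} → z ∈ M → z ∉ R → z ∉ Y ─ R → Void
    side z∈M z∉R z∉Y─R = z∉Y─R (x∈p∧x∉q⇒x∈p─q (M⊆Y z∈M) z∉R)
  ... | around R⊆M | disjoint d₂ = ⊥-elim (M-not-module (module-≐ M⊆R R⊆M mR))
    where
    M⊆R : M ⊆ R
    M⊆R {z} z∈M with z ∈? R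
    ... | yes z∈R = z∈R
    ... | no  z∉R = ⊥-elim (d₂ z∈M (x∈p∧x∉q⇒x∈p─q (M⊆Y z∈M) z∉R))
  ... | disjoint d₁ | around Y─R⊆M = ⊥-elim (M-not-module (module-≐ M⊆Y─R Y─R⊆M mY─R))
    where
    M⊆Y─R : M ⊆ Y ─ R
    M⊆Y─R {z} z∈M with z ∈? R
    ... | yes z∈R = ⊥-elim (d₁ z∈M z∈R)
    ... | no  z∉R = x∈p∧x∉q⇒x∈p─q (M⊆Y z∈M) z∉R
  ... | around R⊆M | around Y─R⊆M = ⊥-elim (M-not-module (module-≐ M⊆Y Y⊆M mY))
    where
    Y⊆M : Y ⊆ M
    Y⊆M {z} z∈Y with z ∈? R
    ... | yes z∈R = R⊆M z∈R
    ... | no  z∉R = Y─R⊆M (x∈p∧x∉q⇒x∈p─q z∈Y z∉R)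

  Minimal : Subset N → Set
  Minimal Y = ∀ Y' → IsModule A Y' → M ⊆ Y' → Y' ⊆ Y → Y ⊆ Y'

  module MinimalModule (Y : Subset N) (mY : IsModule A Y) (M⊆Y : M ⊆ Y) (minY : Minimal Y) where

    -- Y is strong: a module overlapping Y properly would cut a smaller module
    -- containing M out of Y (Y ∩ M' or Y ∖ M', depending on how M meets M').
    strong : ∀ M' → IsModule A M' → Laminar Y M'
    strong M' mM' with FinP.any? (λ z → (z ∈? Y) ×-dec (z ∈? M'))
    ... | no none = disjoint λ {z} z∈Y z∈M' → none (z , z∈Y , z∈M')
    ... | yes (a , a∈Y , a∈M') with Y ⊆? M' | M' ⊆? Y
    ...   | yes Y⊆M' | _        = within Y⊆M'
    ...   | no  _    | yes M'⊆Y = around M'⊆Y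
    ...   | no  Y⊈M' | no  M'⊈Y with ⊈⇒witness Y⊈M' | ⊈⇒witness M'⊈Y
    ...     | b , b∈Y , b∉M' | w , w∈M' , w∉Y with M-laminar M' mM'
    ...       | within M⊆M' = ⊥-elim (b∉M' (proj₂ (x∈p∩q⁻ Y M'
                  (minY (Y ∩ M') (module-∩ mY mM') (λ z → x∈p∩q⁺ (M⊆Y z , M⊆M' z)) (p∩q⊆p Y M') b∈Y))))
    ...       | around M'⊆M = ⊥-elim (w∉Y (M⊆Y (M'⊆M w∈M')))
    ...       | disjoint d = ⊥-elim (x∈p─q⇒x∉q {p = Y}
                  (minY (Y ─ M') (module-─ sym mY mM' w w∈M' w∉Y)
                        (λ z → x∈p∧x∉q⇒x∈p─q (M⊆Y z) (d z)) (p─q⊆p Y M') a∈Y) a∈M')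

    -- B[Y] is connected whenever every pair of distinct B-non-adjacent
    -- vertices has the same A-value c: a component of B[Y] avoiding some
    -- vertex of Y would split Y into two modules (cut-modules), and M would
    -- lie on one side (one-side), contradicting minimality of Y.
    connected : (B : Adj N) (c : Bool) → SymmetricAdj B →
      (∀ a v → a ≢ v → B a v ≡ false → A a v ≡ c) → Connected B Y
    connected B c symB link x y x∈Y y∈Y with Reachability.walk-or-cut B Y x y
    ... | inj₁ walk = walk
    ... | inj₂ (R₀ , x∈R₀ , y∉R₀ , closed) = ⊥-elim separated
      where
      R : Subset N
      R = R₀ ∩ Y
      R⊆Y : R ⊆ Y
      R⊆Y = p∩q⊆q R₀ Y
      across : ∀ a v → a ∈ R → v ∈ Y ─ R → A a v ≡ c
      across a v a∈R v∈ = link a v (λ a≡v → x∈p─q⇒x∉q {p = Y} v∈ (subst (_∈ R) a≡v a∈R)) non-edge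
        where
        non-edge : B a v ≡ false
        non-edge with B a v in e
        ... | false = refl
        ... | true  = ⊥-elim (x∈p─q⇒x∉q {p = Y} v∈
                        (x∈p∩q⁺ (closed a v (p∩q⊆p R₀ Y a∈R) (p─q⊆p Y R v∈) e , p─q⊆p Y R v∈)))
      module-R : IsModule A R
      module-R = proj₁ (cut-modules sym c mY R⊆Y across)
      module-Y─R : IsModule A (Y ─ R)
      module-Y─R = proj₂ (cut-modules sym c mY R⊆Y across)
      separated : Void
      separated with one-side mY M⊆Y module-R module-Y─R
      ... | inj₁ M⊆R   = y∉R₀ (p∩q⊆p R₀ Y (minY R module-R M⊆R R⊆Y y∈Y))
      ... | inj₂ M⊆Y─R = x∈p─q⇒x∉q {p = Y} (minY (Y ─ R) module-Y─R M⊆Y─R (p─q⊆p Y R) x∈Y)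
                                            (x∈p∩q⁺ (x∈R₀ , x∈Y))

    -- |Y| ≥ 2 since Y ⊇ M; connectivity of G[Y] uses B = A, c = false, and
    -- of the complement uses B = co A, c = true.
    prime : IsPrime A Y
    prime with two-elements
    ... | x , y , x∈M , y∈M , x≢y =
      (mY , λ M' mM' → laminar⇒trichotomy (strong M' mM'))
      , distinct⇒∣p∣≥2 (M⊆Y x∈M) (M⊆Y y∈M) x≢y
      , connected A false sym (λ _ _ _ e → e)
      , connected (co A) true (co-sym A sym) (co-nonedge⇒edge A)

  minimal-module-below : ∀ c X → ∣ X ∣ ℕ.≤ c → IsModule A X → M ⊆ X →
    Σ (Subset N) λ Y → IsModule A Y × M ⊆ Y × Y ⊆ X × Minimal Y
  minimal-module-below c X size mX M⊆X
    with anySubset? {P = λ X' → IsModule A X' × M ⊆ X' × X' ⊆ X × ¬ (X ⊆ X')}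
           (λ X' → module? A X' ×-dec (M ⊆? X') ×-dec (X' ⊆? X) ×-dec ¬? (X ⊆? X'))
  ... | no none = X , mX , M⊆X , (λ z → z) , minimal
    where
    minimal : Minimal X
    minimal X' mX' M⊆X' X'⊆X with X ⊆? X'
    ... | yes X⊆X' = X⊆X'
    ... | no  X⊈X' = ⊥-elim (none (X' , mX' , M⊆X' , X'⊆X , X⊈X'))
  ... | yes (X' , mX' , M⊆X' , X'⊆X , X⊈X') with ⊈⇒witness X⊈X'
  ...   | w , w∈X , w∉X' = shrink c size
    where
    smaller : ∣ X' ∣ ℕ.< ∣ X ∣
    smaller = p⊂q⇒∣p∣<∣q∣ (X'⊆X , w , w∈X , w∉X')
    shrink : ∀ c → ∣ X ∣ ℕ.≤ c → Σ (Subset N) λ Y → IsModule A Y × M ⊆ Y × Y ⊆ X × Minimal Y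
    shrink zero    size' = ⊥-elim (ℕP.<⇒≱ (ℕP.<-≤-trans smaller size') ℕ.z≤n)
    shrink (suc c) size' with minimal-module-below c X' (ℕP.≤-pred (ℕP.≤-trans smaller size')) mX' M⊆X'
    ... | Y , mY , M⊆Y , Y⊆X' , minY = Y , mY , M⊆Y , X'⊆X ∘ Y⊆X' , minY

  -- (1) Every module containing M contains the minimal prime module P ⊇ M:
  -- P is laminar with the minimal module Y ⊇ M inside X, and Y ⊆ P would make
  -- the prime module Y equal to P.
  prime-hull-⊆ : ∀ {P} → IsMinPrimeContaining A M P → ∀ X → IsModule A X → M ⊆ X → P ⊆ X
  prime-hull-⊆ {P} (prime-P , M⊆P , minimal-P) X mX M⊆X
    with minimal-module-below ∣ X ∣ X ℕP.≤-refl mX M⊆X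
  ... | Y , mY , M⊆Y , Y⊆X , minY with trichotomy⇒laminar (proj₂ (proj₁ prime-P) Y mY)
  ...   | within P⊆Y  = Y⊆X ∘ P⊆Y
  ...   | around Y⊆P = λ z∈P → Y⊆X (subst (_ ∈_)
                            (≡-sym (minimal-P Y (MinimalModule.prime Y mY M⊆Y minY) M⊆Y Y⊆P)) z∈P)
  ...   | disjoint d with two-elements
  ...     | x , _ , x∈M , _ = ⊥-elim (d (M⊆P x∈M) (M⊆Y x∈M))

lookup-both-∈ : ∀ {S : Subset N} {x y} → x ∈ S → y ∈ S → lookup S x ≡ lookup S y
lookup-both-∈ x∈S y∈S = trans (∈⇒lookup x∈S) (≡-sym (∈⇒lookup y∈S))

lookup-both-∉ : ∀ {S : Subset N} {x y} → x ∉ S → y ∉ S → lookup S x ≡ lookup S y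
lookup-both-∉ x∉S y∉S = trans (∉⇒lookup x∉S) (≡-sym (∉⇒lookup y∉S))

module _ {N} (F : Adj N) (M P : Subset N) where

  FM-cong : ∀ x y v → F x v ≡ F y v → lookup M x ≡ lookup M y → lookup P x ≡ lookup P y →
            FM F M P x v ≡ FM F M P y v
  FM-cong x y v eF eM eP rewrite eF | eM | eP = refl

  FM-outside : ∀ x v → lookup M x ≡ false → lookup M v ≡ false → FM F M P x v ≡ false
  FM-outside x v x∉M v∉M rewrite x∉M | v∉M = ∧-zeroʳ (F x v)

  FM-far : ∀ x v → lookup P v ≡ false → lookup M v ≡ false → FM F M P x v ≡ false
  FM-far x v v∉P v∉M rewrite v∉P | v∉M with lookup M x
  ... | true  = ∧-zeroʳ (F x v)
  ... | false = ∧-zeroʳ (F x v)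

  FM-between : ∀ x v → lookup M x ≡ true → lookup P v ≡ true → lookup M v ≡ false →
               FM F M P x v ≡ F x v
  FM-between x v x∈M v∈P v∉M rewrite x∈M | v∈P | v∉M with lookup P x
  ... | true  = ∧-identityʳ (F x v)
  ... | false = ∧-identityʳ (F x v)

  FM⊆F : ∀ x v → F x v ≡ false → FM F M P x v ≡ false
  FM⊆F x v ¬Fxv rewrite ¬Fxv = refl

edit-module : ∀ {A F : Adj N} {X} → IsModule A X → IsModule (A △ F) X → IsModule F X
edit-module mA mAF x y v x∈ y∈ v∉ = xor-cancelˡ (mA x y v x∈ y∈ v∉) (mAF x y v x∈ y∈ v∉)

-- (2a) Under the conclusions of (1), F_M is uniform on every module X of A
-- on which F is uniform: M and P are laminar with X, and if M ⊆ X then the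
-- outside vertex v lies outside P, so no pair xv is in F_M.
FM-module : ∀ {A F : Adj N} {M P : Subset N} →
  (∀ X → IsModule A X → IsModule F X) →
  (∀ X → IsModule A X → Laminar M X) → (∀ X → IsModule A X → Laminar P X) → M ⊆ P →
  (∀ X → IsModule A X → M ⊆ X → P ⊆ X) →
  ∀ X → IsModule A X → IsModule (FM F M P) X
FM-module {F = F} {M} {P} F-module M-laminar P-laminar M⊆P hull X mX x y v x∈X y∈X v∉X
  with M-laminar X mX
... | within M⊆X = trans (FM-far F M P x v (∉⇒lookup v∉P) (∉⇒lookup (v∉P ∘ M⊆P)))
                         (≡-sym (FM-far F M P y v (∉⇒lookup v∉P) (∉⇒lookup (v∉P ∘ M⊆P))))
  where
  v∉P : v ∉ P
  v∉P = v∉X ∘ hull X mX M⊆X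
... | around X⊆M = FM-cong F M P x y v (F-module X mX x y v x∈X y∈X v∉X)
                       (lookup-both-∈ (X⊆M x∈X) (X⊆M y∈X)) (lookup-both-∈ (M⊆P (X⊆M x∈X)) (M⊆P (X⊆M y∈X)))
... | disjoint d with v ∈? M
...   | no v∉M = trans (FM-outside F M P x v (∉⇒lookup (λ x∈M → d x∈M x∈X)) (∉⇒lookup v∉M))
                       (≡-sym (FM-outside F M P y v (∉⇒lookup (λ y∈M → d y∈M y∈X)) (∉⇒lookup v∉M)))
...   | yes v∈M with P-laminar X mX
...     | within P⊆X = ⊥-elim (v∉X (P⊆X (M⊆P v∈M)))
...     | around X⊆P = FM-cong F M P x y v (F-module X mX x y v x∈X y∈X v∉X)
                           (lookup-both-∉ (λ x∈M → d x∈M x∈X) (λ y∈M → d y∈M y∈X))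
                           (lookup-both-∈ (X⊆P x∈X) (X⊆P y∈X))
...     | disjoint d' = FM-cong F M P x y v (F-module X mX x y v x∈X y∈X v∉X)
                           (lookup-both-∉ (λ x∈M → d x∈M x∈X) (λ y∈M → d y∈M y∈X))
                           (lookup-both-∉ (λ x∈P → d' x∈P x∈X) (λ y∈P → d' y∈P y∈X))

module _ {N n} (A F : Adj N) (Ms P : Fin n → Subset N) (i : Fin n) where

  edits : Fin N → Fin N → Bool
  edits x v = orBelow (λ k → FM F (Ms k) (P k) x v) (suc (toℕ i))

  -- G_i = G △ (F_1 ∪ … ∪ F_i), as the σ_k only make the F_k disjoint.
  Gi-as-union : ∀ x v → Gi A F Ms P i x v ≡ A x v xor edits x v
  Gi-as-union x v = cong (A x v xor_) (orBelow-disjointify (λ k → FM F (Ms k) (P k) x v) (suc (toℕ i)))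

  Gi-module : ∀ {X} → IsModule A X → (∀ k → IsModule (FM F (Ms k) (P k)) X) →
              IsModule (Gi A F Ms P i) X
  Gi-module mA mF x y v x∈ y∈ v∉ = begin
    Gi A F Ms P i x v  ≡⟨ Gi-as-union x v ⟩
    A x v xor edits x v ≡⟨ cong₂ _xor_ (mA x y v x∈ y∈ v∉)
                                       (orBelow-cong (λ k → mF k x y v x∈ y∈ v∉) (suc (toℕ i))) ⟩
    A y v xor edits y v ≡⟨ ≡-sym (Gi-as-union y v) ⟩
    Gi A F Ms P i y v  ∎
    where open ≡-Reasoning

  Gi-between : ∀ j → j ≤ i → ∀ x v → x ∈ Ms j → v ∈ P j → v ∉ Ms j →
               Gi A F Ms P i x v ≡ (A △ F) x v
  Gi-between j j≤i x v x∈M v∈P v∉M = trans (Gi-as-union x v) (cong (A x v xor_) (edits≡F (F x v) refl))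
    where
    edits≡F : ∀ b → F x v ≡ b → edits x v ≡ F x v
    edits≡F true  Fxv = trans (orBelow-witness _ j (suc (toℕ i))
      (trans (FM-between F (Ms j) (P j) x v (∈⇒lookup x∈M) (∈⇒lookup v∈P) (∉⇒lookup v∉M)) Fxv)
      (s≤s j≤i)) (≡-sym Fxv)
    edits≡F false Fxv = trans (orBelow-none _ (suc (toℕ i))
      (λ k → FM⊆F F (Ms k) (P k) x v Fxv)) (≡-sym Fxv)

lemma6 : ∀ {N} (G F : SimpleRel N) → IsOptimal G F → IsModulePreserving G F →
    (n : ℕ) (Ms : Fin n → Subset N) →
    (∀ i j → Ms i ≡ Ms j → i ≡ j) →
    (∀ i → IsStrong (rel G △ rel F) (Ms i) × ¬ IsModule (rel G) (Ms i)) →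
    (∀ M → IsStrong (rel G △ rel F) M → ¬ IsModule (rel G) M → ∃ λ i → Ms i ≡ M) →
    (∀ i j → Ms i ⊆ Ms j → i ≤ j) →
    (P : Fin n → Subset N) → (∀ i → IsMinPrimeContaining (rel G) (Ms i) (P i)) →
    ∀ i → (∀ M → IsModule (rel G) M → IsModule (Gi (rel G) (rel F) Ms P i) M) ×
          (∀ j → j ≤ i → IsModule (Gi (rel G) (rel F) Ms P i) (Ms j))
lemma6 {N} G F _ preserving n Ms _ M*-props _ _ P minP i = modules-of-G , modules-M*
  where
  A : Adj N
  A = rel G
  M*-laminar : ∀ k X → IsModule A X → Laminar (Ms k) X
  M*-laminar k X mX = trichotomy⇒laminar (proj₂ (proj₁ (M*-props k)) X (preserving X mX))
  P-module : ∀ k → IsModule A (P k)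
  P-module k = proj₁ (proj₁ (proj₁ (minP k)))
  P-laminar : ∀ k X → IsModule A X → Laminar (P k) X
  P-laminar k X mX = trichotomy⇒laminar (proj₂ (proj₁ (proj₁ (minP k))) X mX)
  M*⊆P : ∀ k → Ms k ⊆ P k
  M*⊆P k = proj₁ (proj₂ (minP k))
  hull : ∀ k X → IsModule A X → Ms k ⊆ X → P k ⊆ X
  hull k = Primality.prime-hull-⊆ A (SimpleRel.sym G) (Ms k) (proj₂ (M*-props k)) (M*-laminar k) (minP k)
  Fk-module : ∀ X → IsModule A X → ∀ k → IsModule (FM (rel F) (Ms k) (P k)) X
  Fk-module X mX k = FM-module (λ X' mX' → edit-module mX' (preserving X' mX'))
                       (M*-laminar k) (P-laminar k) (M*⊆P k) (hull k) X mX

  modules-of-G : ∀ M → IsModule A M → IsModule (Gi A (rel F) Ms P i) M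
  modules-of-G M mM = Gi-module A (rel F) Ms P i mM (Fk-module M mM)

  modules-M* : ∀ j → j ≤ i → IsModule (Gi A (rel F) Ms P i) (Ms j)
  modules-M* j j≤i x y v x∈ y∈ v∉ with v ∈? P j
  ... | yes v∈P = begin
    Gi A (rel F) Ms P i x v ≡⟨ Gi-between A (rel F) Ms P i j j≤i x v x∈ v∈P v∉ ⟩
    (A △ rel F) x v         ≡⟨ proj₁ (proj₁ (M*-props j)) x y v x∈ y∈ v∉ ⟩
    (A △ rel F) y v         ≡⟨ ≡-sym (Gi-between A (rel F) Ms P i j j≤i y v y∈ v∈P v∉) ⟩
    Gi A (rel F) Ms P i y v ∎
    where open ≡-Reasoning
  ... | no v∉P = modules-of-G (P j) (P-module j) x y v (M*⊆P j x∈) (M*⊆P j y∈) v∉P
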